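{- For every graph $G$ and every integer $k \geq 2$, \[\gamma_k(G)\leq \gamma_{all,k}^\infty(G) \leq \gamma_{\lfloor k/2\rfloor}(G).\]
   Context: Graphs are finite and simple; $d(u,v)$ is graph distance and $N_k[x]=\{v: d(x,v)\le k\}$. A multiset $D$ of vertices of $G$ is a distance-$k$ dominating set if every vertex of $V(G)\setminus D$ is at distance at most $k$ from some element of $D$; $\gamma_k(G)$ denotes the minimum cardinality of such a multiset. Let $\mathbb{D}_{k,q}(G)$ be the set of such multisets of cardinality $q$. $D=\{v_1,\dots,v_q\}$ transforms to $D'=\{u_1,\dots,u_q\}$ if (for some indexing) $u_i\in N_k[v_i]$ for all $i$. An eternal distance-$k$ dominating family is $\mathcal{E}\subseteq\mathbb{D}_{k,q}(G)$ for some $q$ such that for every $D\in\mathcal{E}$ and every vertex $v$ there is $D'\in\mathcal{E}$ with $v\in D'$ and $D$ transforms to $D'$. $\gamma_{all,k}^\infty(G)$ is the minimum $q$ for which such a family exists. -}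

module Defs where

open import Data.Nat using (ℕ; zero; suc; _≤_)
open import Data.Fin using (Fin)
open import Data.Product using (Σ; ∃; ∃-syntax; _×_)
open import Data.Sum using (_⊎_)
open import Relation.Binary.PropositionalEquality using (_≡_)
open import Relation.Nullary using (¬_; Dec)
open import Function.Bundles using (_↔_)
import Level
open import Level using (Lift)

record Graph (n : ℕ) : Set₁ where
  field
    Adj    : Fin n → Fin n → Set
    sym    : ∀ {u v} → Adj u v → Adj v u
    irrefl : ∀ {u} → ¬ Adj u u
    adj?   : ∀ u v → Dec (Adj u v)
open Graph public

-- Within G k u v  :⇔  d(u,v) ≤ k  (there is a walk of length ≤ k from u to v),
-- i.e. v ∈ N_k[u].
Within : ∀ {n} → Graph n → ℕ → Fin n → Fin n → Set
Within G zero    u v = u ≡ v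
Within G (suc k) u v = u ≡ v ⊎ ∃[ w ] (Adj G u w × Within G k w v)

-- A multiset of q vertices is represented by an indexing Fin q → Fin n.
Multiset : ℕ → ℕ → Set
Multiset n q = Fin q → Fin n

_∈ₘ_ : ∀ {n q} → Fin n → Multiset n q → Set
v ∈ₘ D = ∃[ i ] (D i ≡ v)

IsDistDom : ∀ {n q} → Graph n → ℕ → Multiset n q → Set
IsDistDom G k D = ∀ v → v ∈ₘ D ⊎ ∃[ i ] Within G k (D i) v

Transforms : ∀ {n q} → Graph n → ℕ → Multiset n q → Multiset n q → Set
Transforms {q = q} G k D D' =
  Σ (Fin q ↔ Fin q) λ π → ∀ i → Within G k (D i) (D' (Function.Bundles.Inverse.to π i))

record EternalFamily {n : ℕ} (G : Graph n) (k q : ℕ) : Set₁ where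
  field
    Fam      : Multiset n q → Set
    nonempty : ∃[ D ] Fam D
    dom      : ∀ D → Fam D → IsDistDom G k D
    eternal  : ∀ D → Fam D → ∀ v →
               ∃[ D' ] (Fam D' × v ∈ₘ D' × Transforms G k D D')

IsMinimum : (ℕ → Set₁) → ℕ → Set₁
IsMinimum P m = P m × (∀ q → P q → m ≤ q)

HasDistDom : ∀ {n} → Graph n → ℕ → ℕ → Set₁
HasDistDom {n} G k q = Lift (Level.suc Level.zero) (∃[ D ] IsDistDom {n} {q} G k D)

HasEternal : ∀ {n} → Graph n → ℕ → ℕ → Set₁
HasEternal G k q = EternalFamily G k q

IsGammaK : ∀ {n} → Graph n → ℕ → ℕ → Set₁
IsGammaK G k = IsMinimum (HasDistDom G k)

IsGammaAllInf : ∀ {n} → Graph n → ℕ → ℕ → Set₁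
IsGammaAllInf G k = IsMinimum (HasEternal G k)

-- The lower bound holds because every member of an eternal family is itself a
-- distance-k dominating multiset.  For the upper bound, fix a distance-h
-- dominating multiset D₀ with 2h ≤ k and let the i-th guard roam in the ball
-- N_h[D₀ i] around its home: an attacked vertex v lies in some ball N_h[D₀ j],
-- and guard j, being in the same ball, reaches v in at most 2h ≤ k steps while
-- all other guards stay put; with h = ⌊k/2⌋ this gives an eternal family of
-- size γ_⌊k/2⌋.  That the minimum γ∞ exists needs a finiteness argument: an
-- eternal family of q-multisets may be replaced by a set of codes in
-- Fin (n ^ q), and for such sets eternity is decidable.
module Submission where

open import Defs hiding (sym)
open import Data.Nat using (ℕ; zero; suc; _+_; _≤_; _<_; ⌊_/2⌋; _^_; z≤n; s≤s)
open import Data.Nat.Properties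
  using (≤-trans; ≤-reflexive; m≤n+m; n≤1+n; n<1+n; ≮⇒≥; +-monoʳ-≤;
         m<1+n⇒m<n∨m≡n; ⌊n/2⌋≤⌈n/2⌉; ⌊n/2⌋+⌈n/2⌉≡n)
open import Data.Fin using (Fin; punchIn; finToFun; funToFin) renaming (zero to fzero; suc to fsuc)
open import Data.Fin.Properties using (any?; all?; _≟_; finToFun-funToFin)
open import Data.Fin.Permutation using (Permutation′; _⟨$⟩ʳ_; insert; remove; insert-punchIn; insert-remove)
open import Data.Fin.Subset using (Subset; _∈_; Nonempty)
open import Data.Fin.Subset.Properties using (_∈?_; nonempty?; anySubset?)
open import Data.Vec using (tabulate)
open import Data.Vec.Properties using (lookup∘tabulate; []=⇒lookup; lookup⇒[]=)
open import Data.Vec.Functional using (updateAt)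
open import Data.Vec.Functional.Properties using (updateAt-updates; updateAt-minimal)
open import Data.Product using (Σ; ∃; ∃-syntax; _×_; _,_; proj₁; proj₂)
open import Data.Sum using (_⊎_; inj₁; inj₂; [_,_])
open import Function using (_∘_; const)
open import Function.Construct.Identity using (↔-id)
open import Level using (Level; lift)
open import Relation.Binary.PropositionalEquality using (_≡_; _≢_; refl; sym; trans; subst; subst₂; _≗_)
open import Relation.Nullary using (Dec; yes; no; does; ¬_; contradiction)
open import Relation.Nullary.Decidable using (_⊎-dec_; _×-dec_; _→-dec_; map′; dec-true; ¬¬-excluded-middle)
open import Relation.Unary using (Pred)

module _ {P : ℕ → Set₁} (P? : ∀ q → Dec (P q)) where

  first-is-least : ∀ {b} → (∀ q → q < b → ¬ P q) → P b → IsMinimum P b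
  first-is-least none pb = pb , λ q pq → ≮⇒≥ (λ q<b → none q q<b pq)

  search : ∀ b → (∀ q → q < b → ¬ P q) ⊎ ∃ (IsMinimum P)
  search zero = inj₁ (λ _ ())
  search (suc b) with search b
  ... | inj₂ least = inj₂ least
  ... | inj₁ none with P? b
  ...   | yes pb = inj₂ (b , first-is-least none pb)
  ...   | no ¬pb = inj₁ λ q q<1+b → [ none q , (λ { refl → ¬pb }) ] (m<1+n⇒m<n∨m≡n q<1+b)

  least-witness : ∀ {b} → P b → ∃ (IsMinimum P)
  least-witness {b} pb with search (suc b)
  ... | inj₁ none  = contradiction pb (none b (n<1+n b))
  ... | inj₂ least = least

¬¬-decide : ∀ {m ℓ} (P : Pred (Fin m) ℓ) → ¬ ¬ (∀ i → Dec (P i))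
¬¬-decide {zero}  P undecidable = undecidable λ ()
¬¬-decide {suc m} P undecidable = ¬¬-excluded-middle λ P₀? → ¬¬-decide (P ∘ fsuc) λ P₊? →
  undecidable λ { fzero → P₀? ; (fsuc i) → P₊? i }

module _ {m : ℕ} {ℓ : Level} {P : Pred (Fin m) ℓ} where

  characteristic : (∀ i → Dec (P i)) → Subset m
  characteristic P? = tabulate (does ∘ P?)

  ∈-characteristic⁺ : (P? : ∀ i → Dec (P i)) → ∀ {i} → P i → i ∈ characteristic P?
  ∈-characteristic⁺ P? {i} p = lookup⇒[]= i _ (trans (lookup∘tabulate (does ∘ P?) i) (dec-true (P? i) p))

  ∈-characteristic⁻ : (P? : ∀ i → Dec (P i)) → ∀ {i} → i ∈ characteristic P? → P i
  ∈-characteristic⁻ P? {i} i∈S with P? i | trans (sym (lookup∘tabulate (does ∘ P?) i)) ([]=⇒lookup i∈S)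
  ... | yes p | _  = p
  ... | no _  | ()

PerfectMatching : ∀ {m} → (Fin m → Fin m → Set) → Set
PerfectMatching {m} R = Σ (Permutation′ m) λ π → ∀ i → R i (π ⟨$⟩ʳ i)

-- Choose the partner j of 0 and match the remaining rows into the columns ≠ j.
perfectMatching? : ∀ {m} {R : Fin m → Fin m → Set} → (∀ i j → Dec (R i j)) → Dec (PerfectMatching R)
perfectMatching? {zero}      R? = yes (↔-id _ , λ ())
perfectMatching? {suc m} {R} R? =
  map′ extend restrict (any? λ j → R? fzero j ×-dec perfectMatching? (λ i j′ → R? (fsuc i) (punchIn j j′)))
  where
  Rest : Fin (suc m) → Set
  Rest j = PerfectMatching (λ i j′ → R (fsuc i) (punchIn j j′))

  extend : ∃[ j ] (R fzero j × Rest j) → PerfectMatching R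
  extend (j , r₀ , π , r) = insert fzero j π , λ
    { fzero    → r₀
    ; (fsuc i) → subst (R (fsuc i)) (sym (insert-punchIn fzero j π i)) (r i) }

  restrict : PerfectMatching R → ∃[ j ] (R fzero j × Rest j)
  restrict (π , r) = π ⟨$⟩ʳ fzero , r fzero , remove fzero π , λ i →
    subst (R (fsuc i))
      (trans (sym (insert-remove fzero π (fsuc i))) (insert-punchIn fzero (π ⟨$⟩ʳ fzero) (remove fzero π) i))
      (r (fsuc i))

updateAt-const-pointwise : ∀ {A : Set} {m} (P : Fin m → A → Set) (xs : Fin m → A) j {v} →
                           P j v → (∀ i → i ≢ j → P i (xs i)) → ∀ i → P i (updateAt xs j (const v) i)
updateAt-const-pointwise P xs j Pjv Pxs i with i ≟ j
... | yes refl = subst (P j) (sym (updateAt-updates j xs)) Pjv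
... | no i≢j   = subst (P i) (sym (updateAt-minimal i j xs i≢j)) (Pxs i i≢j)

⌊n/2⌋+⌊n/2⌋≤n : ∀ n → ⌊ n /2⌋ + ⌊ n /2⌋ ≤ n
⌊n/2⌋+⌊n/2⌋≤n n = ≤-trans (+-monoʳ-≤ ⌊ n /2⌋ (⌊n/2⌋≤⌈n/2⌉ n)) (≤-reflexive (⌊n/2⌋+⌈n/2⌉≡n n))

module _ {n : ℕ} (G : Graph n) where

  within-refl : ∀ k u → Within G k u u
  within-refl zero    u = refl
  within-refl (suc k) u = inj₁ refl

  within-snoc : ∀ k {u w v} → Within G k u w → Adj G w v → Within G (suc k) u v
  within-snoc zero    {v = v} refl                   w~v = inj₂ (v , w~v , refl)
  within-snoc (suc k) {v = v} (inj₁ refl)            w~v = inj₂ (v , w~v , within-refl (suc k) v)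
  within-snoc (suc k)         (inj₂ (x , u~x , x-w)) w~v = inj₂ (x , u~x , within-snoc k x-w w~v)

  within-sym : ∀ k {u v} → Within G k u v → Within G k v u
  within-sym zero    u≡v                    = sym u≡v
  within-sym (suc k) (inj₁ u≡v)             = inj₁ (sym u≡v)
  within-sym (suc k) (inj₂ (w , u~w , w-v)) = within-snoc k (within-sym k w-v) (Graph.sym G u~w)

  within-mono : ∀ {a b u v} → a ≤ b → Within G a u v → Within G b u v
  within-mono {b = b} z≤n       refl                   = within-refl b _
  within-mono         (s≤s _)   (inj₁ u≡v)             = inj₁ u≡v
  within-mono         (s≤s a≤b) (inj₂ (w , u~w , w-v)) = inj₂ (w , u~w , within-mono a≤b w-v)

  within-trans : ∀ a b {u w v} → Within G a u w → Within G b w v → Within G (a + b) u v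
  within-trans zero    b refl                   w-v = w-v
  within-trans (suc a) b (inj₁ refl)            w-v = within-mono (≤-trans (m≤n+m b a) (n≤1+n _)) w-v
  within-trans (suc a) b (inj₂ (x , u~x , x-w)) w-v = inj₂ (x , u~x , within-trans a b x-w w-v)

  within? : ∀ k u v → Dec (Within G k u v)
  within? zero    u v = u ≟ v
  within? (suc k) u v = (u ≟ v) ⊎-dec any? (λ w → adj? G u w ×-dec within? k w v)

hasDistDom-fromEternal : ∀ {n} {G : Graph n} {k q} → EternalFamily G k q → HasDistDom G k q
hasDistDom-fromEternal E = lift (proj₁ nonempty , dom _ (proj₂ nonempty))
  where open EternalFamily E

module _ {n : ℕ} (G : Graph n) (k : ℕ) where

  ∈ₘ? : ∀ {q} v (D : Multiset n q) → Dec (v ∈ₘ D)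
  ∈ₘ? v D = any? (λ i → D i ≟ v)

  isDistDom? : ∀ {q} (D : Multiset n q) → Dec (IsDistDom G k D)
  isDistDom? D = all? λ v → ∈ₘ? v D ⊎-dec any? (λ i → within? G k (D i) v)

  transforms? : ∀ {q} (D D′ : Multiset n q) → Dec (Transforms G k D D′)
  transforms? D D′ = perfectMatching? (λ i j → within? G k (D i) (D′ j))

  ∈ₘ-resp-≗ : ∀ {q v} {D D′ : Multiset n q} → D ≗ D′ → v ∈ₘ D → v ∈ₘ D′
  ∈ₘ-resp-≗ D≗D′ (i , Di≡v) = i , trans (sym (D≗D′ i)) Di≡v

  isDistDom-resp-≗ : ∀ {q} {D D′ : Multiset n q} → D ≗ D′ → IsDistDom G k D → IsDistDom G k D′
  isDistDom-resp-≗ D≗D′ dom v with dom v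
  ... | inj₁ v∈D        = inj₁ (∈ₘ-resp-≗ D≗D′ v∈D)
  ... | inj₂ (i , Di-v) = inj₂ (i , subst (λ u → Within G k u v) (D≗D′ i) Di-v)

  transforms-resp-≗ : ∀ {q} {D₁ D₁′ D₂ D₂′ : Multiset n q} → D₁ ≗ D₁′ → D₂ ≗ D₂′ →
                      Transforms G k D₁ D₂ → Transforms G k D₁′ D₂′
  transforms-resp-≗ D₁≗D₁′ D₂≗D₂′ (π , moves) =
    π , λ i → subst₂ (Within G k) (D₁≗D₁′ i) (D₂≗D₂′ (π ⟨$⟩ʳ i)) (moves i)

  module Coding (q : ℕ) where

    decode : Fin (n ^ q) → Multiset n q
    decode = finToFun

    encode : Multiset n q → Fin (n ^ q)
    encode = funToFin

    -- A family is taken up to pointwise equality of multisets, as a set of codes.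
    Defensible : Subset (n ^ q) → Fin (n ^ q) → Set
    Defensible S c = IsDistDom G k (decode c) ×
      ∀ v → ∃[ c′ ] (c′ ∈ S × v ∈ₘ decode c′ × Transforms G k (decode c) (decode c′))

    IsEternalCode : Subset (n ^ q) → Set
    IsEternalCode S = Nonempty S × ∀ c → c ∈ S → Defensible S c

    isEternalCode? : ∀ S → Dec (IsEternalCode S)
    isEternalCode? S = nonempty? S ×-dec all? λ c → c ∈? S →-dec (isDistDom? (decode c) ×-dec
      all? λ v → any? λ c′ → c′ ∈? S ×-dec ∈ₘ? v (decode c′) ×-dec transforms? (decode c) (decode c′))

    eternalFamily-fromCode : ∀ {S} → IsEternalCode S → EternalFamily G k q
    eternalFamily-fromCode {S} ((c₀ , c₀∈S) , defensible) =
      record { Fam = Fam ; nonempty = decode c₀ , c₀ , c₀∈S , refl ; dom = dom ; eternal = eternal }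
      where
      Fam : Multiset n q → Set
      Fam D = ∃[ c ] (c ∈ S × decode c ≡ D)

      dom : ∀ D → Fam D → IsDistDom G k D
      dom _ (c , c∈S , refl) = proj₁ (defensible c c∈S)

      eternal : ∀ D → Fam D → ∀ v → ∃[ D′ ] (Fam D′ × v ∈ₘ D′ × Transforms G k D D′)
      eternal _ (c , c∈S , refl) v with proj₂ (defensible c c∈S) v
      ... | c′ , c′∈S , v∈D′ , D→D′ = decode c′ , (c′ , c′∈S , refl) , v∈D′ , D→D′

    -- Membership in a family is not decidable, but deciding it on each of the
    -- finitely many codes is possible under a double negation.
    ¬¬eternalCode : EternalFamily G k q → ¬ ¬ ∃ IsEternalCode
    ¬¬eternalCode E noCode =
      ¬¬-decide Coded λ Coded? → noCode (characteristic Coded? , eternal-characteristic Coded?)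
      where
      open EternalFamily E
      Coded : Pred (Fin (n ^ q)) _
      Coded c = ∃[ D ] (Fam D × decode c ≗ D)

      coded : ∀ {D} → Fam D → Coded (encode D)
      coded {D} D∈E = D , D∈E , finToFun-funToFin D

      eternal-characteristic : (Coded? : ∀ c → Dec (Coded c)) → IsEternalCode (characteristic Coded?)
      eternal-characteristic Coded? =
        (encode (proj₁ nonempty) , ∈-characteristic⁺ Coded? (coded (proj₂ nonempty))) ,
        λ c c∈S → defensible (∈-characteristic⁻ Coded? c∈S)
        where
        S = characteristic Coded?

        defensible : ∀ {c} → Coded c → Defensible S c
        defensible {c} (D , D∈E , c≗D) = isDistDom-resp-≗ (sym ∘ c≗D) (dom D D∈E) , answer
          where
          answer : ∀ v → ∃[ c′ ] (c′ ∈ S × v ∈ₘ decode c′ × Transforms G k (decode c) (decode c′))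
          answer v with eternal D D∈E v
          ... | D′ , D′∈E , v∈D′ , D→D′ =
            encode D′ , ∈-characteristic⁺ Coded? (coded D′∈E) , ∈ₘ-resp-≗ D′≗ v∈D′ ,
            transforms-resp-≗ (sym ∘ c≗D) D′≗ D→D′
            where
            D′≗ : D′ ≗ decode (encode D′)
            D′≗ = sym ∘ finToFun-funToFin D′

  hasEternal? : ∀ q → Dec (HasEternal G k q)
  hasEternal? q with anySubset? (Coding.isEternalCode? q)
  ... | yes (_ , code) = yes (Coding.eternalFamily-fromCode q code)
  ... | no noCode      = no λ E → Coding.¬¬eternalCode q E noCode

module _ {n} (G : Graph n) {h k : ℕ} (h+h≤k : h + h ≤ k) {q} {D₀ : Multiset n q} (D₀-dom : IsDistDom G h D₀) where

  home : ∀ v → ∃[ j ] Within G h (D₀ j) v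
  home v with D₀-dom v
  ... | inj₁ (j , D₀j≡v) = j , subst (Within G h (D₀ j)) D₀j≡v (within-refl G h (D₀ j))
  ... | inj₂ near        = near

  Roaming : Multiset n q → Set
  Roaming D = ∀ i → Within G h (D₀ i) (D i)

  reach : ∀ {D j v} → Roaming D → Within G h (D₀ j) v → Within G k (D j) v
  reach {j = j} roam D₀j-v = within-mono G h+h≤k (within-trans G h h (within-sym G h (roam j)) D₀j-v)

  defend : ∀ D → Roaming D → ∀ v → ∃[ D′ ] (Roaming D′ × v ∈ₘ D′ × Transforms G k D D′)
  defend D roam v with home v
  ... | j , D₀j-v =
    updateAt D j (const v) ,
    updateAt-const-pointwise (λ i → Within G h (D₀ i)) D j D₀j-v (λ i _ → roam i) ,
    (j , updateAt-updates j D) ,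
    ↔-id _ ,
    updateAt-const-pointwise (λ i → Within G k (D i)) D j (reach roam D₀j-v) (λ i _ → within-refl G k (D i))

  eternalFamily-fromDistDom : EternalFamily G k q
  eternalFamily-fromDistDom = record
    { Fam      = Roaming
    ; nonempty = D₀ , λ i → within-refl G h (D₀ i)
    ; dom      = λ D roam v → inj₂ (proj₁ (home v) , reach roam (proj₂ (home v)))
    ; eternal  = defend
    }

proposition1 : ∀ {n} (G : Graph n) (k : ℕ) → 2 ≤ k →
    ∀ g₁ g₃ → IsGammaK G k g₁ → IsGammaK G ⌊ k /2⌋ g₃ →
    ∃[ g₂ ] (IsGammaAllInf G k g₂ × g₁ ≤ g₂ × g₂ ≤ g₃)
proposition1 G k _ g₁ g₃ (_ , γₖ-least) (lift (D₀ , D₀-dom) , _) =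
  bounds (least-witness (hasEternal? G k) E₃)
  where
  E₃ : EternalFamily G k g₃
  E₃ = eternalFamily-fromDistDom G (⌊n/2⌋+⌊n/2⌋≤n k) D₀-dom

  bounds : ∃ (IsGammaAllInf G k) → ∃[ g₂ ] (IsGammaAllInf G k g₂ × g₁ ≤ g₂ × g₂ ≤ g₃)
  bounds (g₂ , γ∞@(E₂ , γ∞-least)) = g₂ , γ∞ , γₖ-least g₂ (hasDistDom-fromEternal E₂) , γ∞-least g₃ E₃
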